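{- Let $c\ge 1$ and $k_1,\ldots,k_c\ge 2$ be integers, and put $M=\sum_{i=1}^c(k_i-1)$. Let $R_{\mathrm{cop}}(k_1,\ldots,k_c)$ be the least positive integer $n$ such that for every coloring $\chi:\{1,\ldots,n\}\to\{1,\ldots,c\}$ there is a color $i$ for which $\chi^{ -1}(i)$ contains $k_i$ pairwise coprime integers. Then \[ R_{\mathrm{cop}}(k_1,\ldots,k_c)=p_M, \] where $p_m$ denotes the $m$-th prime ($p_1=2$, $p_2=3,\ldots$).
   Context: A set of pairwise coprime integers means a set of distinct positive integers any two of which have greatest common divisor $1$ (the integer $1$ is coprime to every integer). Equivalently, such a set is a clique in the coprime graph $G_n$ on vertex set $\{1,\dots,n\}$, where distinct $a,b$ are adjacent iff $\gcd(a,b)=1$. -}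

module Defs where

open import Data.Nat using (ℕ; zero; suc; _+_; _∸_; _≤_; _<_)
open import Data.Nat.Primality using (Prime; prime?)
open import Data.Nat.Coprimality using (Coprime)
open import Data.Fin using (Fin)
open import Data.Nat.ListAction using (sum)
open import Data.List using (List; length; map; allFin; filter; upTo)
open import Data.List.Membership.Propositional using (_∈_)
open import Data.List.Relation.Unary.All using (All)
open import Data.List.Relation.Unary.AllPairs using (AllPairs)
open import Relation.Binary.PropositionalEquality using (_≡_)
open import Relation.Nullary using (¬_)
open import Data.Product using (_×_; Σ; ∃)

sumFin : (c : ℕ) → (Fin c → ℕ) → ℕ
sumFin c f = sum (map f (allFin c))

primesBelow : ℕ → ℕ
primesBelow n = length (filter prime? (upTo n))

-- p is the m-th prime (p_1 = 2, p_2 = 3, ...): p is prime and exactly m-1 primes are < p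
IsNthPrime : ℕ → ℕ → Set
IsNthPrime m p = Prime p × suc (primesBelow p) ≡ m

-- A list xs is a set of k pairwise coprime integers from {1,..,n}, all of colour i under χ
-- (distinctness follows from pairwise coprimality of entries > 1, but is included via
--  AllPairs of "≢ and coprime" to literally match "distinct")
open import Relation.Binary.PropositionalEquality using (_≢_)

CoprimeDistinct : ℕ → ℕ → Set
CoprimeDistinct a b = a ≢ b × Coprime a b

MonoCoprimeSet : {c : ℕ} → (n : ℕ) → (χ : ℕ → Fin c) → (i : Fin c) → (k : ℕ) → List ℕ → Set
MonoCoprimeSet n χ i k xs =
  length xs ≡ k × AllPairs CoprimeDistinct xs ×
  All (λ x → (1 ≤ x × x ≤ n) × χ x ≡ i) xs

-- Ramsey property for n: every c-colouring of {1..n} has a colour i whose class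
-- contains k i pairwise coprime integers. (Colourings are given as functions on ℕ;
-- only their values on {1..n} matter.)
CopRamsey : (c : ℕ) → (k : Fin c → ℕ) → ℕ → Set
CopRamsey c k n = (χ : ℕ → Fin c) → Σ (Fin c) λ i → ∃ λ xs → MonoCoprimeSet n χ i (k i) xs

IsLeastPos : (ℕ → Set) → ℕ → Set
IsLeastPos P n = 1 ≤ n × P n × (∀ m → 1 ≤ m → m < n → ¬ P m)

{-# OPTIONS --safe #-}
module Submission where

-- Write π n for the number of primes ≤ n and M = Σᵢ (kᵢ − 1).
-- Upper bound: 1 together with the primes ≤ n are π n + 1 pairwise coprime numbers, so when
-- M ≤ π n some colour class i contains more than kᵢ − 1 of them.
-- Lower bound: rank 1 as 0 and x ≥ 2 as j when a prime factor of x is the j-th prime.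
-- Pairwise coprime numbers have distinct ranks, and numbers ≤ n have ranks ≤ π n. If π n < M,
-- cut 0, 1, …, M − 1 into consecutive blocks of lengths kᵢ − 1 and colour x by the block of its
-- rank: then class i holds at most kᵢ − 1 pairwise coprime numbers.
-- Finally π (p_M) = M, while π n ≤ M − 1 for n < p_M.

open import Defs
open import Algebra.Properties.CommutativeMonoid.Sum using ()
open import Data.Bool.Base using (if_then_else_)
open import Data.Fin.Base using (Fin; zero; suc; fromℕ<)
open import Data.Fin.Properties using (_≟_; injective⇒≤; fromℕ<-injective; ¬∀⟶∃¬)
open import Data.List.Base using (List; []; _∷_; [_]; _++_; _∷ʳ_; length; map; filter; upTo; take; lookup; tabulate)
open import Data.List.Properties using (upTo-∷ʳ; filter-++; length-++; filter-accept; length-map; length-take; map-tabulate)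
open import Data.List.Membership.Propositional.Properties using (∈-lookup; ∈-upTo⁻)
open import Data.List.Relation.Unary.All as All using (All; []; _∷_)
import Data.List.Relation.Unary.All.Properties as All
open import Data.List.Relation.Unary.AllPairs using (AllPairs; []; _∷_)
import Data.List.Relation.Unary.AllPairs.Properties as AllPairs
open import Data.List.Relation.Unary.Unique.Propositional using (Unique)
open import Data.Nat.Base using (ℕ; zero; suc; _+_; _∸_; _≤_; _<_; _≤′_; ≤′-refl; ≤′-step; z≤n; s≤s; s≤s⁻¹; >-nonZero⁻¹)
open import Data.Nat.Properties hiding (_≟_)
open import Data.Nat.Coprimality as Coprime using (prime⇒coprime; 1-coprimeTo)
open import Data.Nat.Divisibility using (_∣_; ∣⇒≤; m∣m*n)
open import Data.Nat.ListAction using (sum; product)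
open import Data.Nat.Primality using (Prime; prime?; ¬prime[1]; prime⇒nonZero)
open import Data.Nat.Primality.Factorisation using (factorise)
open import Data.Product as Product using (_×_; _,_; proj₁; proj₂; ∃)
open import Function.Base using (_∘_; id)
open import Relation.Binary.Definitions using (tri<; tri≈; tri>)
open import Relation.Binary.PropositionalEquality using (_≡_; _≢_; refl; sym; trans; cong; cong₂; subst; module ≡-Reasoning)
open import Relation.Nullary using (¬_; yes; no; does; contradiction)

open Algebra.Properties.CommutativeMonoid.Sum +-0-commutativeMonoid
  using (∑-distrib-+; sum-cong-≗; sum-replicate-zero) renaming (sum to ∑)

private
  variable
    A : Set
    c m n p q : ℕ

allPairs-map-with-All : {P : A → Set} {R S : A → A → Set} →
  (∀ {x y} → P x → P y → R x y → S x y) →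
  ∀ {xs} → All P xs → AllPairs R xs → AllPairs S xs
allPairs-map-with-All h [] [] = []
allPairs-map-with-All h (px ∷ pxs) (rx ∷ rxs) =
  All.zipWith (λ (py , rxy) → h px py rxy) (pxs , rx) ∷ allPairs-map-with-All h pxs rxs

unique-lookup-injective : ∀ {xs : List A} → Unique xs → ∀ {s t} → lookup xs s ≡ lookup xs t → s ≡ t
unique-lookup-injective (_ ∷ _) {zero} {zero} _ = refl
unique-lookup-injective (x∉ ∷ _) {zero} {suc t} eq = contradiction eq (All.lookup x∉ (∈-lookup t))
unique-lookup-injective (x∉ ∷ _) {suc s} {zero} eq = contradiction (sym eq) (All.lookup x∉ (∈-lookup s))
unique-lookup-injective (_ ∷ u) {suc s} {suc t} eq = cong suc (unique-lookup-injective u eq)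

unique-in-interval⇒length≤ : ∀ {a} {ys : List ℕ} → Unique ys →
  All (λ y → a ≤ y × y ∸ a < n) ys → length ys ≤ n
unique-in-interval⇒length≤ {n} {a} {ys} u inInterval = injective⇒≤ {f = index} index-injective
  where
  bounds : ∀ t → a ≤ lookup ys t × lookup ys t ∸ a < n
  bounds t = All.lookup inInterval (∈-lookup t)

  index : Fin (length ys) → Fin n
  index t = fromℕ< (proj₂ (bounds t))

  index-injective : ∀ {s t} → index s ≡ index t → s ≡ t
  index-injective {s} {t} eq = unique-lookup-injective u
    (∸-cancelʳ-≡ (proj₁ (bounds s)) (proj₁ (bounds t)) (fromℕ<-injective _ _ _ _ eq))

sumFin≡∑ : ∀ c (f : Fin c → ℕ) → sumFin c f ≡ ∑ f
sumFin≡∑ c f = trans (cong sum (map-tabulate id f)) (sum-tabulate f)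
  where
  sum-tabulate : ∀ {c} (g : Fin c → ℕ) → sum (tabulate g) ≡ ∑ g
  sum-tabulate {zero} g = refl
  sum-tabulate {suc c} g = cong (g zero +_) (sum-tabulate (g ∘ suc))

∑-mono-≤ : {f g : Fin c → ℕ} → (∀ i → f i ≤ g i) → ∑ f ≤ ∑ g
∑-mono-≤ {zero} _ = z≤n
∑-mono-≤ {suc c} f≤g = +-mono-≤ (f≤g zero) (∑-mono-≤ (f≤g ∘ suc))

fibre : (A → Fin c) → Fin c → List A → List A
fibre g i = filter (λ x → g x ≟ i)

δ : Fin c → Fin c → ℕ
δ j i = if does (j ≟ i) then 1 else 0

∑-δ : (j : Fin c) → ∑ (δ j) ≡ 1
∑-δ {suc c} zero = cong suc (sum-replicate-zero c)
∑-δ {suc c} (suc j) = ∑-δ j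

length-fibre-∷ : ∀ (g : A → Fin c) i x xs →
  length (fibre g i (x ∷ xs)) ≡ δ (g x) i + length (fibre g i xs)
length-fibre-∷ g i x xs with g x ≟ i
... | yes _ = refl
... | no _ = refl

length≡∑-length-fibre : ∀ (g : A → Fin c) xs → length xs ≡ ∑ (λ i → length (fibre g i xs))
length≡∑-length-fibre {c = c} g [] = sym (sum-replicate-zero c)
length≡∑-length-fibre g (x ∷ xs) = begin
  1 + length xs
    ≡⟨ cong₂ _+_ (sym (∑-δ (g x))) (length≡∑-length-fibre g xs) ⟩
  ∑ (δ (g x)) + ∑ (λ i → length (fibre g i xs))
    ≡⟨ ∑-distrib-+ (δ (g x)) _ ⟨
  ∑ (λ i → δ (g x) i + length (fibre g i xs))
    ≡⟨ sum-cong-≗ (λ i → length-fibre-∷ g i x xs) ⟨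
  ∑ (λ i → length (fibre g i (x ∷ xs))) ∎
  where open ≡-Reasoning

pigeonhole-fibre : ∀ (f : Fin c → ℕ) (g : A → Fin c) {xs} → ∑ f < length xs →
  ∃ λ i → f i < length (fibre g i xs)
pigeonhole-fibre {c} f g {xs} ∑f<|xs| =
  Product.map₂ ≰⇒> (¬∀⟶∃¬ c (λ i → length (fibre g i xs) ≤ f i) (λ i → _ ≤? _) ¬allSmall)
  where
  ¬allSmall : ¬ (∀ i → length (fibre g i xs) ≤ f i)
  ¬allSmall allSmall = <⇒≱ ∑f<|xs|
    (≤-trans (≤-reflexive (length≡∑-length-fibre g xs)) (∑-mono-≤ allSmall))

block : (Fin (suc c) → ℕ) → ℕ → Fin (suc c)
block {zero} f y = zero
block {suc c} f y with y <? f zero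
... | yes _ = zero
... | no _ = suc (block (f ∘ suc) (y ∸ f zero))

offset : (Fin c → ℕ) → Fin c → ℕ
offset f zero = 0
offset f (suc i) = f zero + offset (f ∘ suc) i

block-interval : ∀ (f : Fin (suc c) → ℕ) {y} → y < ∑ f →
  offset f (block f y) ≤ y × y ∸ offset f (block f y) < f (block f y)
block-interval {zero} f y<∑f = z≤n , ≤-trans y<∑f (≤-reflexive (+-identityʳ _))
block-interval {suc c} f {y} y<∑f with y <? f zero
... | yes y<f₀ = z≤n , y<f₀
... | no y≮f₀ = Product.map shift-≤ shift-< (block-interval (f ∘ suc) y′<∑)
  where
  f₀+y′≡y : f zero + (y ∸ f zero) ≡ y
  f₀+y′≡y = m+[n∸m]≡n (≮⇒≥ y≮f₀)

  y′<∑ : y ∸ f zero < ∑ (f ∘ suc)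
  y′<∑ = +-cancelˡ-< (f zero) _ _ (subst (_< ∑ f) (sym f₀+y′≡y) y<∑f)

  shift-≤ : ∀ {o} → o ≤ y ∸ f zero → f zero + o ≤ y
  shift-≤ o≤y′ = ≤-trans (+-monoʳ-≤ (f zero) o≤y′) (≤-reflexive f₀+y′≡y)

  shift-< : ∀ {o b} → y ∸ f zero ∸ o < b → y ∸ (f zero + o) < b
  shift-< {o} {b} = subst (_< b) (∸-+-assoc y (f zero) o)

π : ℕ → ℕ
π n = primesBelow (suc n)

primesBelow-suc : ∀ n → primesBelow (suc n) ≡ primesBelow n + length (filter prime? [ n ])
primesBelow-suc n = begin
  length (filter prime? (upTo (suc n)))
    ≡⟨ cong (length ∘ filter prime?) (upTo-∷ʳ n) ⟨
  length (filter prime? (upTo n ∷ʳ n))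
    ≡⟨ cong length (filter-++ prime? (upTo n) [ n ]) ⟩
  length (filter prime? (upTo n) ++ filter prime? [ n ])
    ≡⟨ length-++ (filter prime? (upTo n)) ⟩
  primesBelow n + length (filter prime? [ n ]) ∎
  where open ≡-Reasoning

primesBelow-≤-suc : ∀ n → primesBelow n ≤ primesBelow (suc n)
primesBelow-≤-suc n = ≤-trans (m≤m+n _ _) (≤-reflexive (sym (primesBelow-suc n)))

primesBelow-suc-prime : Prime p → primesBelow (suc p) ≡ suc (primesBelow p)
primesBelow-suc-prime {p} p-prime = begin
  primesBelow (suc p)                          ≡⟨ primesBelow-suc p ⟩
  primesBelow p + length (filter prime? [ p ]) ≡⟨ cong (λ ps → primesBelow p + length ps) (filter-accept prime? p-prime) ⟩
  primesBelow p + 1                            ≡⟨ +-comm _ 1 ⟩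
  suc (primesBelow p)                          ∎
  where open ≡-Reasoning

primesBelow-mono-≤ : m ≤ n → primesBelow m ≤ primesBelow n
primesBelow-mono-≤ = mono ∘ ≤⇒≤′
  where
  mono : m ≤′ n → primesBelow m ≤ primesBelow n
  mono ≤′-refl = ≤-refl
  mono (≤′-step {n} m≤′n) = ≤-trans (mono m≤′n) (primesBelow-≤-suc n)

primesBelow-mono-< : Prime p → p < n → primesBelow p < primesBelow n
primesBelow-mono-< p-prime p<n =
  ≤-trans (≤-reflexive (sym (primesBelow-suc-prime p-prime))) (primesBelow-mono-≤ p<n)

primesBelow-injective : Prime p → Prime q → primesBelow p ≡ primesBelow q → p ≡ q
primesBelow-injective {p} {q} p-prime q-prime eq with <-cmp p q
... | tri< p<q _ _ = contradiction eq (<⇒≢ (primesBelow-mono-< p-prime p<q))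
... | tri≈ _ p≡q _ = p≡q
... | tri> _ _ q<p = contradiction (sym eq) (<⇒≢ (primesBelow-mono-< q-prime q<p))

prime⇒1≤ : Prime p → 1 ≤ p
prime⇒1≤ {p} p-prime = >-nonZero⁻¹ p {{prime⇒nonZero p-prime}}

oneAndPrimesUpTo : ℕ → List ℕ
oneAndPrimesUpTo n = 1 ∷ filter prime? (upTo (suc n))

coprimeDistinct-primes : Prime p → Prime q → p < q → CoprimeDistinct p q
coprimeDistinct-primes p-prime q-prime p<q =
  <⇒≢ p<q , Coprime.sym (prime⇒coprime q-prime {{prime⇒nonZero p-prime}} p<q)

coprimeDistinct-1-prime : Prime q → CoprimeDistinct 1 q
coprimeDistinct-1-prime {q} q-prime = (λ 1≡q → ¬prime[1] (subst Prime (sym 1≡q) q-prime)) , 1-coprimeTo q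

oneAndPrimesUpTo-coprimeDistinct : ∀ n → AllPairs CoprimeDistinct (oneAndPrimesUpTo n)
oneAndPrimesUpTo-coprimeDistinct n =
  All.map coprimeDistinct-1-prime (All.all-filter prime? (upTo (suc n))) ∷
  allPairs-map-with-All coprimeDistinct-primes (All.all-filter prime? (upTo (suc n)))
    (AllPairs.filter⁺ prime? (AllPairs.applyUpTo⁺₁ id (suc n) (λ i<j _ → i<j)))

oneAndPrimesUpTo-⊆-[1,n] : 1 ≤ n → All (λ x → 1 ≤ x × x ≤ n) (oneAndPrimesUpTo n)
oneAndPrimesUpTo-⊆-[1,n] {n} 1≤n = (≤-refl , 1≤n) ∷
  All.zipWith (λ (q-prime , q<1+n) → prime⇒1≤ q-prime , s≤s⁻¹ q<1+n)
    (All.all-filter prime? (upTo (suc n)) , All.filter⁺ prime? (All.tabulate ∈-upTo⁻))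

monoCoprimeSet-take-fibre : ∀ {c k xs} (χ : ℕ → Fin c) (i : Fin c) →
  AllPairs CoprimeDistinct xs → All (λ x → 1 ≤ x × x ≤ n) xs → k ≤ length (fibre χ i xs) →
  MonoCoprimeSet n χ i k (take k (fibre χ i xs))
monoCoprimeSet-take-fibre {k = k} {xs} χ i coprime inRange k≤ =
  trans (length-take k _) (m≤n⇒m⊓n≡m k≤) ,
  AllPairs.take⁺ k (AllPairs.filter⁺ _ coprime) ,
  All.take⁺ k (All.zip (All.filter⁺ _ inRange , All.all-filter _ xs))

copRamsey-of-∑≤π : ∀ {c} (k : Fin c → ℕ) → 1 ≤ n → ∑ (λ i → k i ∸ 1) ≤ π n → CopRamsey c k n
copRamsey-of-∑≤π {n} k 1≤n ∑≤π χ
  with i , fᵢ<|fibre| ← pigeonhole-fibre (λ i → k i ∸ 1) χ {oneAndPrimesUpTo n} (s≤s ∑≤π)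
  = i , _ , monoCoprimeSet-take-fibre χ i (oneAndPrimesUpTo-coprimeDistinct n)
              (oneAndPrimesUpTo-⊆-[1,n] 1≤n) (≤-trans (m≤n+m∸n (k i) 1) fᵢ<|fibre|)

primeFactor : ∀ m → ∃ λ q → Prime q × q ∣ 2 + m
primeFactor m with factorise (2 + m)
... | record { factors = q ∷ qs ; isFactorisation = 2+m≡q*Πqs ; factorsPrime = q-prime ∷ _ } =
  q , q-prime , subst (q ∣_) (sym 2+m≡q*Πqs) (m∣m*n (product qs))

rank : ℕ → ℕ
rank (suc (suc m)) = suc (primesBelow (proj₁ (primeFactor m)))
rank _ = 0

rank-injective : 1 ≤ m → 1 ≤ n → CoprimeDistinct m n → rank m ≢ rank n
rank-injective {1} {1} _ _ (1≢1 , _) _ = 1≢1 refl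
rank-injective {1} {suc (suc _)} _ _ _ ()
rank-injective {suc (suc _)} {1} _ _ _ ()
rank-injective {suc (suc m)} {suc (suc n)} _ _ (_ , coprime) eq
  with q , q-prime , q∣m ← primeFactor m | r , r-prime , r∣n ← primeFactor n
  with refl ← primesBelow-injective q-prime r-prime (suc-injective eq)
  = ¬prime[1] (subst Prime (coprime (q∣m , r∣n)) q-prime)

rank-≤π : m ≤ n → rank m ≤ π n
rank-≤π {0} _ = z≤n
rank-≤π {1} _ = z≤n
rank-≤π {suc (suc m)} {n} 2+m≤n with q , q-prime , q∣m ← primeFactor m = begin
  suc (primesBelow q)  ≡⟨ primesBelow-suc-prime q-prime ⟨
  primesBelow (suc q)  ≤⟨ primesBelow-mono-≤ (s≤s (≤-trans (∣⇒≤ q∣m) 2+m≤n)) ⟩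
  π n                  ∎
  where open ≤-Reasoning

¬copRamsey-of-π<∑ : ∀ (k : Fin (suc c) → ℕ) → (∀ i → 1 ≤ k i) →
  π n < ∑ (λ i → k i ∸ 1) → ¬ CopRamsey (suc c) k n
¬copRamsey-of-π<∑ {c = c} {n = n} k k≥1 π<∑ copRamsey
  with i , xs , |xs|≡kᵢ , coprime , inRange ← copRamsey (block (λ i → k i ∸ 1) ∘ rank)
  = contradiction kᵢ≤fᵢ (<⇒≱ (∸-monoʳ-< (s≤s z≤n) (k≥1 i)))
  where
  f : Fin (suc c) → ℕ
  f i = k i ∸ 1

  rank-in-block : ∀ {x} → (1 ≤ x × x ≤ n) × block f (rank x) ≡ i →
    offset f i ≤ rank x × rank x ∸ offset f i < f i
  rank-in-block {x} ((_ , x≤n) , refl) = block-interval f (≤-<-trans (rank-≤π x≤n) π<∑)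

  kᵢ≤fᵢ : k i ≤ f i
  kᵢ≤fᵢ = begin
    k i                   ≡⟨ |xs|≡kᵢ ⟨
    length xs             ≡⟨ length-map rank xs ⟨
    length (map rank xs)  ≤⟨ unique-in-interval⇒length≤
                               (AllPairs.map⁺ (allPairs-map-with-All rank-injective
                                 (All.map (proj₁ ∘ proj₁) inRange) coprime))
                               (All.map⁺ (All.map rank-in-block inRange)) ⟩
    f i                   ∎
    where open ≤-Reasoning

theorem3p2 : (c : ℕ) → 1 ≤ c → (k : Fin c → ℕ) → (∀ i → 2 ≤ k i) →
    (p : ℕ) → IsNthPrime (sumFin c (λ i → k i ∸ 1)) p →
    IsLeastPos (CopRamsey c k) p
theorem3p2 zero ()
theorem3p2 (suc c) _ k k≥2 p (p-prime , 1+primesBelow-p≡M) =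
  prime⇒1≤ p-prime ,
  copRamsey-of-∑≤π k (prime⇒1≤ p-prime) (≤-reflexive M≡πp) ,
  λ m _ m<p → ¬copRamsey-of-π<∑ k k≥1 (πm<M m<p)
  where
  M≡1+primesBelow-p : ∑ (λ i → k i ∸ 1) ≡ suc (primesBelow p)
  M≡1+primesBelow-p = trans (sym (sumFin≡∑ (suc c) _)) (sym 1+primesBelow-p≡M)

  M≡πp : ∑ (λ i → k i ∸ 1) ≡ π p
  M≡πp = trans M≡1+primesBelow-p (sym (primesBelow-suc-prime p-prime))

  πm<M : ∀ {m} → m < p → π m < ∑ (λ i → k i ∸ 1)
  πm<M m<p = ≤-trans (s≤s (primesBelow-mono-≤ m<p)) (≤-reflexive (sym M≡1+primesBelow-p))

  k≥1 : ∀ i → 1 ≤ k i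
  k≥1 i = ≤-trans (s≤s z≤n) (k≥2 i)
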